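{- For all nonnegative integers $n$ and $L$, \[ P(n) \leq L + P(g^{2L}(n)) + \sum_{i=0}^{2L-1} f(g^{i}(n)) \qquad\text{and}\qquad Q(n) \leq L + Q(g^{2L}(n)) + \sum_{i=0}^{2L-1} f(g^{i}(n)). \]
   Context: For $A \subseteq \{0,1,2,\ldots\}$, $\partial A = \{z \in A : \{z-1,z+1\} \not\subseteq A\}$, $vol(A)=\sum_{z\in A} z$, $per(A) = \sum_{z \in \partial A} z$ (both $0$ for the empty set), and $A^c = \{0,1,2,\ldots\}\setminus A$. For integers $n\ge 0$, $P(n) = \min\{per(A) : A \subseteq \{0,1,\ldots\},\ vol(A)=n\}$ and $Q(n) = \min\{per(A^c) : A \subseteq \{0,1,\ldots\},\ vol(A) = n\}$. Also $f(n) = \lceil (-1+\sqrt{1+8n})/2 \rceil$, $g(n) = f(n)(f(n)+1)/2 - n$, and $g^i$ is the $i$-fold composition of $g$ with $g^0(n) = n$. -}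

module Defs where

open import Data.Nat using (ℕ; zero; suc; _+_; _*_; _∸_; _≤ᵇ_; _≡ᵇ_; _⊓_)
open import Data.Bool using (Bool; true; false; not; _∧_; _∨_; if_then_else_)
open import Data.Nat.ListAction using (sum)
open import Data.List using (List; []; _∷_; length; map; upTo; concatMap; foldr; filter; replicate; _++_)

-- A finite subset A of {0,1,2,...} is represented by its characteristic
-- list: index z of the list is the membership bit of z; all z ≥ length
-- are not in A.  (Every A with vol(A) = n is finite, indeed ⊆ {0,…,n}.)
FinSet : Set
FinSet = List Bool

mem : FinSet → ℕ → Bool
mem []      _       = false
mem (b ∷ _) zero    = b
mem (_ ∷ A) (suc z) = mem A z

memPred : FinSet → ℕ → Bool
memPred A zero    = false
memPred A (suc z) = mem A z

inBd : FinSet → ℕ → Bool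
inBd A z = mem A z ∧ (not (memPred A z) ∨ not (mem A (suc z)))

-- z ∈ ∂(A^c)  :⇔  z ∈ A^c and {z-1, z+1} ⊈ A^c
-- (z-1 ∉ A^c iff z = 0 or z-1 ∈ A; z+1 ∉ A^c iff z+1 ∈ A)
inBdC : FinSet → ℕ → Bool
inBdC A zero    = not (mem A zero)
inBdC A (suc z) = not (mem A (suc z)) ∧ (mem A z ∨ mem A (suc (suc z)))

sumWhere : (ℕ → Bool) → ℕ → ℕ
sumWhere p N = sum (map (λ z → if p z then z else 0) (upTo N))

vol : FinSet → ℕ
vol A = sumWhere (mem A) (length A)

-- per(A): ∂A ⊆ A ⊆ {0,…,length A - 1}
per : FinSet → ℕ
per A = sumWhere (inBd A) (length A)

-- per(A^c): every z ∈ ∂(A^c) is ≤ length A (for z > length A, z±1 ∈ A^c)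
perC : FinSet → ℕ
perC A = sumWhere (inBdC A) (suc (suc (length A)))

subsetsBelow : ℕ → List FinSet
subsetsBelow zero    = [] ∷ []
subsetsBelow (suc k) = concatMap (λ A → (false ∷ A) ∷ (true ∷ A) ∷ []) (subsetsBelow k)

-- the subsets A with vol(A) = n (all of them lie in {0,…,n})
volSets : ℕ → List FinSet
volSets n = filter (λ A → vol A Data.Nat.≟ n) (subsetsBelow (suc n))

-- the singleton {n}, which has volume n (a witness making the minimum well defined)
single : ℕ → FinSet
single n = replicate n false ++ (true ∷ [])

minimum : ℕ → List ℕ → ℕ
minimum d xs = foldr _⊓_ d xs

P : ℕ → ℕ
P n = minimum (per (single n)) (map per (volSets n))

Q : ℕ → ℕ
Q n = minimum (perC (single n)) (map perC (volSets n))

-- triangular numbers T k = k(k+1)/2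
T : ℕ → ℕ
T zero    = 0
T (suc k) = suc k + T k

-- f(n) = ⌈(-1+√(1+8n))/2⌉ = least k ∈ ℕ with n ≤ k(k+1)/2
-- (search k = start, start+1, …; fuel n suffices since n ≤ T n)
fSearch : ℕ → ℕ → ℕ → ℕ
fSearch n zero       k = k
fSearch n (suc fuel) k = if n ≤ᵇ T k then k else fSearch n fuel (suc k)

f : ℕ → ℕ
f n = fSearch n n 0

g : ℕ → ℕ
g n = T (f n) ∸ n

_^[_] : (ℕ → ℕ) → ℕ → ℕ → ℕ
(h ^[ zero ]) x  = x
(h ^[ suc i ]) x = h ((h ^[ i ]) x)

sumBelow : ℕ → (ℕ → ℕ) → ℕ
sumBelow zero    a = 0
sumBelow (suc N) a = sumBelow N a + a N

module Submission where

-- Proof of Corollary 11.  Write k = f n, m = g n = T k − n, k' = f m and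
-- m' = g m = T k' − m; then m' ≤ k' ≤ k ≤ n.  If B ⊆ {0, …, m'} has volume
-- m', then A = B ∪ {k'+1, …, k} is a disjoint union of volume
-- m' + (T k − T k') = n, and every boundary point of A (resp. of A^c) is a
-- boundary point of B (resp. of B^c) or an end point k'+1, k (resp. k',
-- k+1) of the interval.  Taking B optimal gives the two-step recursion
--   P(n) ≤ 1 + f(n) + f(g n) + P(g(g n)),   and the same for Q,
-- which unfolded L times is the corollary.

open import Defs
open import Data.Nat using (ℕ; _≟_; zero; suc; _+_; _*_; _∸_; _≤_; _<_; _≤ᵇ_; _≡ᵇ_; z≤n; s≤s; s≤s⁻¹)
open import Data.Nat.Properties
open import Data.Nat.ListAction using (sum)
open import Data.Nat.ListAction.Properties using (sum-++)
open import Data.Nat.Tactic.RingSolver using (solve-∀)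
open import Data.Bool using (Bool; true; false; not; _∧_; _∨_; if_then_else_) renaming (T to True)
open import Data.Bool.Properties using (T-∧; T-∨)
open import Data.List using (List; []; _∷_; _++_; length; map; upTo; _∷ʳ_)
open import Data.List.Properties using (upTo-∷ʳ; map-++)
open import Data.List.Membership.Propositional using (_∈_; find)
open import Data.List.Membership.Propositional.Properties using (∈-concatMap⁺; ∈-concatMap⁻; ∈-map⁺; ∈-map⁻; ∈-filter⁺; ∈-filter⁻)
open import Data.List.Relation.Unary.Any using (here; there)
import Data.List.Relation.Unary.Any as Any
open import Data.Product using (Σ; _×_; _,_; proj₁; proj₂)
open import Data.Sum using (_⊎_; inj₁; inj₂)
open import Data.Unit using (tt)
open import Function using (Equivalence)
open import Relation.Nullary using (¬_; yes; no)
open import Relation.Nullary.Negation using (contradiction)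
open import Relation.Binary.PropositionalEquality

DecSet : Set
DecSet = ℕ → Bool

_∪_ : DecSet → DecSet → DecSet
(p ∪ q) z = p z ∨ q z

point : ℕ → DecSet
point c z = z ≡ᵇ c

weight : Bool → ℕ → ℕ
weight b z = if b then z else 0

mass : DecSet → ℕ → ℕ
mass p N = sumBelow N (λ z → weight (p z) z)

weight-∈ : ∀ {b} z → True b → weight b z ≡ z
weight-∈ {true} z _ = refl

weight-∉ : ∀ {b} z → ¬ True b → weight b z ≡ 0
weight-∉ {false} z _ = refl
weight-∉ {true}  z b∉ = contradiction tt b∉

weight-0 : ∀ b → weight b 0 ≡ 0
weight-0 true  = refl
weight-0 false = refl

sumBelow-cong : ∀ N {a b : ℕ → ℕ} → (∀ z → a z ≡ b z) → sumBelow N a ≡ sumBelow N b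
sumBelow-cong zero    a≡b = refl
sumBelow-cong (suc N) a≡b = cong₂ _+_ (sumBelow-cong N a≡b) (a≡b N)

sumBelow-mono : ∀ N {a b : ℕ → ℕ} → (∀ z → a z ≤ b z) → sumBelow N a ≤ sumBelow N b
sumBelow-mono zero    a≤b = z≤n
sumBelow-mono (suc N) a≤b = +-mono-≤ (sumBelow-mono N a≤b) (a≤b N)

sumBelow-+ : ∀ N (a b : ℕ → ℕ) → sumBelow N (λ z → a z + b z) ≡ sumBelow N a + sumBelow N b
sumBelow-+ zero    a b = refl
sumBelow-+ (suc N) a b = begin
    sumBelow N (λ z → a z + b z) + (a N + b N)
  ≡⟨ cong (_+ (a N + b N)) (sumBelow-+ N a b) ⟩
    sumBelow N a + sumBelow N b + (a N + b N)
  ≡⟨ interchange (sumBelow N a) (sumBelow N b) (a N) (b N) ⟩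
    sumBelow N a + a N + (sumBelow N b + b N) ∎
  where
    open ≡-Reasoning
    interchange : ∀ x y u v → x + y + (u + v) ≡ x + u + (y + v)
    interchange = solve-∀

sumWhere≡mass : ∀ p N → sumWhere p N ≡ mass p N
sumWhere≡mass p zero    = refl
sumWhere≡mass p (suc N) = begin
    sum (map h (upTo (suc N)))
  ≡⟨ cong (λ xs → sum (map h xs)) (sym (upTo-∷ʳ N)) ⟩
    sum (map h (upTo N ∷ʳ N))
  ≡⟨ cong sum (map-++ h (upTo N) (N ∷ [])) ⟩
    sum (map h (upTo N) ++ (h N ∷ []))
  ≡⟨ sum-++ (map h (upTo N)) (h N ∷ []) ⟩
    sumWhere p N + (h N + 0)
  ≡⟨ cong₂ _+_ (sumWhere≡mass p N) (+-identityʳ (h N)) ⟩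
    mass p N + h N ∎
  where
    open ≡-Reasoning
    h : ℕ → ℕ
    h z = weight (p z) z

mass-cong : ∀ N {p q : DecSet} → (∀ z → p z ≡ q z) → mass p N ≡ mass q N
mass-cong N p≡q = sumBelow-cong N (λ z → cong (λ b → weight b z) (p≡q z))

mass-disjoint : ∀ N (p q : DecSet) → (∀ z → True (p z) → ¬ True (q z)) →
  mass (p ∪ q) N ≡ mass p N + mass q N
mass-disjoint N p q disjoint = trans (sumBelow-cong N split) (sumBelow-+ N _ _)
  where
    split : ∀ z → weight (p z ∨ q z) z ≡ weight (p z) z + weight (q z) z
    split z with p z in pz
    ... | false = refl
    ... | true  = sym (trans (cong (z +_) (weight-∉ z (disjoint z (subst True (sym pz) tt))))
                             (+-identityʳ z))

-- A set covered by two others has at most their total mass; the point 0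
-- carries no weight, so only positive points need to be covered.
mass-cover : ∀ N (p q r : DecSet) →
  (∀ z → True (p (suc z)) → True (q (suc z)) ⊎ True (r (suc z))) →
  mass p N ≤ mass q N + mass r N
mass-cover N p q r cover = ≤-trans (sumBelow-mono N pointwise) (≤-reflexive (sumBelow-+ N _ _))
  where
    pointwise : ∀ z → weight (p z) z ≤ weight (q z) z + weight (r z) z
    pointwise zero = ≤-trans (≤-reflexive (weight-0 (p 0))) z≤n
    pointwise (suc z) with p (suc z) in pz
    ... | false = z≤n
    ... | true with cover z (subst True (sym pz) tt)
    ...   | inj₁ q∋z = ≤-trans (≤-reflexive (sym (weight-∈ (suc z) q∋z))) (m≤m+n _ _)
    ...   | inj₂ r∋z = ≤-trans (≤-reflexive (sym (weight-∈ (suc z) r∋z))) (m≤n+m _ _)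

mass-empty : ∀ N (p : DecSet) → (∀ z → z < N → ¬ True (p z)) → mass p N ≡ 0
mass-empty zero    p empty = refl
mass-empty (suc N) p empty = cong₂ _+_ (mass-empty N p (λ z z<N → empty z (m<n⇒m<1+n z<N)))
                                        (weight-∉ N (empty N ≤-refl))

mass-beyond : ∀ {M N} (p : DecSet) → (∀ z → M ≤ z → ¬ True (p z)) → M ≤ N →
  mass p N ≡ mass p M
mass-beyond {M} {N} p bounded M≤N = begin
    mass p N
  ≡⟨ cong (mass p) (sym (m∸n+n≡m M≤N)) ⟩
    mass p (N ∸ M + M)
  ≡⟨ extend (N ∸ M) ⟩
    mass p M ∎
  where
    open ≡-Reasoning
    extend : ∀ d → mass p (d + M) ≡ mass p M
    extend zero    = refl
    extend (suc d) = trans (cong₂ _+_ (extend d) (weight-∉ (d + M) (bounded (d + M) (m≤n+m M d))))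
                           (+-identityʳ _)

mass-point : ∀ N c → c < N → mass (point c) N ≡ c
mass-point (suc N) c c<1+N with m≤n⇒m<n∨m≡n (s≤s⁻¹ c<1+N)
... | inj₁ c<N = trans (cong₂ _+_ (mass-point N c c<N)
                                 (weight-∉ N (λ N≡c → <⇒≢ c<N (sym (≡ᵇ⇒≡ N c N≡c)))))
                       (+-identityʳ c)
... | inj₂ refl = cong₂ _+_ (mass-empty N (point N) (λ z z<N z≡N → <⇒≢ z<N (≡ᵇ⇒≡ z N z≡N)))
                            (weight-∈ N (≡⇒≡ᵇ N N refl))

mass-point-≤ : ∀ N c → mass (point c) N ≤ c
mass-point-≤ N c with c <? N
... | yes c<N = ≤-reflexive (mass-point N c c<N)
... | no  c≮N = ≤-trans (≤-reflexive (mass-empty N (point c) outside)) z≤n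
  where
    outside : ∀ z → z < N → ¬ True (point c z)
    outside z z<N z≡c = c≮N (subst (_< N) (≡ᵇ⇒≡ z c z≡c) z<N)

mass-two-points : ∀ N (p : DecSet) c d → (∀ z → True (p (suc z)) → suc z ≡ c ⊎ suc z ≡ d) →
  mass p N ≤ c + d
mass-two-points N p c d inside = ≤-trans (mass-cover N p (point c) (point d) cover)
                                         (+-mono-≤ (mass-point-≤ N c) (mass-point-≤ N d))
  where
    cover : ∀ z → True (p (suc z)) → True (point c (suc z)) ⊎ True (point d (suc z))
    cover z p∋z with inside z p∋z
    ... | inj₁ refl = inj₁ (≡⇒≡ᵇ (suc z) (suc z) refl)
    ... | inj₂ refl = inj₂ (≡⇒≡ᵇ (suc z) (suc z) refl)

-- Boundaries.  pre p z says z-1 ∈ p (false for z = 0); bd p is ∂p and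
-- bdᶜ p is ∂(p^c), the boundary of the complement, where -1 counts as
-- outside p^c.
pre : DecSet → DecSet
pre p zero    = false
pre p (suc z) = p z

bd : DecSet → DecSet
bd p z = p z ∧ (not (pre p z) ∨ not (p (suc z)))

bdᶜ : DecSet → DecSet
bdᶜ p zero    = not (p zero)
bdᶜ p (suc z) = not (p (suc z)) ∧ (p z ∨ p (suc (suc z)))

bd-cong : ∀ {p q : DecSet} → (∀ z → p z ≡ q z) → ∀ z → bd p z ≡ bd q z
bd-cong p≡q zero    rewrite p≡q 0 = refl
bd-cong p≡q (suc z) rewrite p≡q z | p≡q (suc z) | p≡q (suc (suc z)) = refl

bdᶜ-cong : ∀ {p q : DecSet} → (∀ z → p z ≡ q z) → ∀ z → bdᶜ p z ≡ bdᶜ q z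
bdᶜ-cong p≡q zero    rewrite p≡q 0 = refl
bdᶜ-cong p≡q (suc z) rewrite p≡q z | p≡q (suc z) | p≡q (suc (suc z)) = refl

-- ∂(p ∪ q) ⊆ ∂p ∪ ∂q: a point of p ∪ q with a neighbour outside p ∪ q has
-- that neighbour outside whichever of p, q contains it.  The Boolean core:
-- a ∈ p, a' ∈ q, l, l' the left and r, r' the right neighbour memberships.
∂-∪ : ∀ a a' l l' r r' → True ((a ∨ a') ∧ (not (l ∨ l') ∨ not (r ∨ r'))) →
  True (a ∧ (not l ∨ not r)) ⊎ True (a' ∧ (not l' ∨ not r'))
∂-∪ true  _    false _    _     _     _ = inj₁ tt
∂-∪ true  _    true  _    false _     _ = inj₁ tt
∂-∪ true  _    true  _    true  _     ()
∂-∪ false true _     false _     _     _ = inj₂ tt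
∂-∪ false true _     true  _     false _ = inj₂ tt
∂-∪ false true true  true  true  true  ()
∂-∪ false true true  true  false true  ()
∂-∪ false true false true  true  true  ()
∂-∪ false true false true  false true  ()

bd-∪ : ∀ p q z → True (bd (p ∪ q) z) → True (bd p z) ⊎ True (bd q z)
bd-∪ p q zero    = ∂-∪ (p 0) (q 0) false false (p 1) (q 1)
bd-∪ p q (suc z) = ∂-∪ (p (suc z)) (q (suc z)) (p z) (q z) (p (suc (suc z))) (q (suc (suc z)))

-- ∂((p ∪ q)^c) ⊆ ∂(p^c) ∪ ∂(q^c): a point outside p ∪ q with a neighbour
-- in p ∪ q has a neighbour in p or in q.
∂ᶜ-∪ : ∀ a a' l l' r r' → True (not (a ∨ a') ∧ ((l ∨ l') ∨ (r ∨ r'))) →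
  True (not a ∧ (l ∨ r)) ⊎ True (not a' ∧ (l' ∨ r'))
∂ᶜ-∪ true  _    _     _ _     _ ()
∂ᶜ-∪ false true _     _ _     _ ()
∂ᶜ-∪ false false true _ _     _ _ = inj₁ tt
∂ᶜ-∪ false false false _ true _ _ = inj₁ tt
∂ᶜ-∪ false false false _ false _ l'∨r' = inj₂ l'∨r'

bdᶜ-∪ : ∀ p q z → True (bdᶜ (p ∪ q) z) → True (bdᶜ p z) ⊎ True (bdᶜ q z)
bdᶜ-∪ p q zero    = outside (p 0) (q 0)
  where
    outside : ∀ a a' → True (not (a ∨ a')) → True (not a) ⊎ True (not a')
    outside false _ _ = inj₁ tt
bdᶜ-∪ p q (suc z) = ∂ᶜ-∪ (p (suc z)) (q (suc z)) (p z) (q z) (p (suc (suc z))) (q (suc (suc z)))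

True-not : ∀ {b} → True (not b) → ¬ True b
True-not {false} _ ()
True-not {true} ()

True-ext : ∀ {a b} → (True a → True b) → (True b → True a) → a ≡ b
True-ext {false} {false} _  _  = refl
True-ext {false} {true}  _  b⇒a = contradiction tt b⇒a
True-ext {true}  {false} a⇒b _  = contradiction tt a⇒b
True-ext {true}  {true}  _  _  = refl

interval : ℕ → ℕ → DecSet
interval k' k z = (suc k' ≤ᵇ z) ∧ (z ≤ᵇ k)

interval-bounds : ∀ k' k z → True (interval k' k z) → k' < z × z ≤ k
interval-bounds k' k z z∈ with Equivalence.to T-∧ z∈
... | lower , upper = ≤ᵇ⇒≤ (suc k') z lower , ≤ᵇ⇒≤ z k upper

interval-intro : ∀ {k' k z} → k' < z → z ≤ k → True (interval k' k z)
interval-intro k'<z z≤k = Equivalence.from T-∧ (≤⇒≤ᵇ k'<z , ≤⇒≤ᵇ z≤k)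

interval-outside : ∀ k' k z → ¬ True (interval k' k z) → z ≤ k' ⊎ k < z
interval-outside k' k z z∉ with k' <? z | z ≤? k
... | yes k'<z | yes z≤k = contradiction (interval-intro k'<z z≤k) z∉
... | no  k'≮z | _       = inj₁ (≮⇒≥ k'≮z)
... | yes _    | no  z≰k = inj₂ (≰⇒> z≰k)

bd-interval : ∀ k' k z → True (bd (interval k' k) z) → z ≡ suc k' ⊎ z ≡ k
bd-interval k' k z z∈∂ with Equivalence.to T-∧ z∈∂
... | z∈ , gap with interval-bounds k' k z z∈ | Equivalence.to T-∨ gap
...   | k'<z , z≤k | inj₁ left  = inj₁ (leftEnd z k'<z z≤k (True-not left))
  where
    leftEnd : ∀ z → k' < z → z ≤ k → ¬ True (pre (interval k' k) z) → z ≡ suc k'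
    leftEnd (suc y) (s≤s k'≤y) 1+y≤k y∉ with interval-outside k' k y y∉
    ... | inj₁ y≤k' = cong suc (≤-antisym y≤k' k'≤y)
    ... | inj₂ k<y  = contradiction (≤-trans (n≤1+n y) 1+y≤k) (<⇒≱ k<y)
...   | k'<z , z≤k | inj₂ right with interval-outside k' k (suc z) (True-not right)
...     | inj₁ 1+z≤k' = contradiction (≤-trans (n≤1+n z) 1+z≤k') (<⇒≱ k'<z)
...     | inj₂ k<1+z  = inj₂ (≤-antisym z≤k (s≤s⁻¹ k<1+z))

bdᶜ-interval : ∀ k' k z → True (bdᶜ (interval k' k) (suc z)) → suc z ≡ k' ⊎ suc z ≡ suc k
bdᶜ-interval k' k z z∈∂ with Equivalence.to T-∧ z∈∂
... | 1+z∉ , touch = ends (interval-outside k' k (suc z) (True-not 1+z∉)) (Equivalence.to T-∨ touch)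
  where
    ends : suc z ≤ k' ⊎ k < suc z →
           True (interval k' k z) ⊎ True (interval k' k (suc (suc z))) →
           suc z ≡ k' ⊎ suc z ≡ suc k
    ends side (inj₁ z∈) with interval-bounds k' k z z∈ | side
    ... | k'<z , _   | inj₁ 1+z≤k' = contradiction (≤-trans (n≤1+n z) 1+z≤k') (<⇒≱ k'<z)
    ... | _    , z≤k | inj₂ k<1+z  = inj₂ (cong suc (≤-antisym z≤k (s≤s⁻¹ k<1+z)))
    ends side (inj₂ 2+z∈) with interval-bounds k' k (suc (suc z)) 2+z∈ | side
    ... | k'<2+z , _     | inj₁ 1+z≤k' = inj₁ (≤-antisym 1+z≤k' (s≤s⁻¹ k'<2+z))
    ... | _      , 2+z≤k | inj₂ k<1+z  = contradiction 2+z≤k (<⇒≱ (m<n⇒m<1+n k<1+z))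

interval-beyond : ∀ k' k z → k < z → ¬ True (interval k' k z)
interval-beyond k' k z k<z z∈ = <⇒≱ k<z (proj₂ (interval-bounds k' k z z∈))

interval-step : ∀ {k' j} → k' ≤ j → ∀ z → interval k' (suc j) z ≡ (interval k' j ∪ point (suc j)) z
interval-step {k'} {j} k'≤j z = True-ext split merge
  where
    split : True (interval k' (suc j) z) → True (interval k' j z ∨ point (suc j) z)
    split z∈ with interval-bounds k' (suc j) z z∈
    ... | k'<z , z≤1+j with m≤n⇒m<n∨m≡n z≤1+j
    ...   | inj₁ z<1+j = Equivalence.from T-∨ (inj₁ (interval-intro k'<z (s≤s⁻¹ z<1+j)))
    ...   | inj₂ refl  = Equivalence.from T-∨ (inj₂ (≡⇒≡ᵇ z z refl))
    merge : True (interval k' j z ∨ point (suc j) z) → True (interval k' (suc j) z)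
    merge z∈ with Equivalence.to T-∨ z∈
    ... | inj₁ z∈′ = let k'<z , z≤j = interval-bounds k' j z z∈′
                     in interval-intro k'<z (m≤n⇒m≤1+n z≤j)
    ... | inj₂ z≡ with ≡ᵇ⇒≡ z (suc j) z≡
    ...   | refl = interval-intro (s≤s k'≤j) ≤-refl

T-mono : ∀ {a b} → a ≤ b → T a ≤ T b
T-mono {b = zero}  z≤n       = z≤n
T-mono {zero}      {suc b} _ = z≤n
T-mono {suc a}     {suc b} (s≤s a≤b) = +-mono-≤ (s≤s a≤b) (T-mono a≤b)

interval-empty : ∀ k z → ¬ True (interval k k z)
interval-empty k z z∈ with interval-bounds k k z z∈
... | k<z , z≤k = <⇒≱ k<z z≤k

mass-interval : ∀ N k' k → k' ≤ k → k < N → mass (interval k' k) N ≡ T k ∸ T k'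
mass-interval N k' k k'≤k k<N with m≤n⇒m<n∨m≡n k'≤k
... | inj₂ refl = trans (mass-empty N (interval k k) (λ z _ → interval-empty k z)) (sym (n∸n≡0 (T k)))
mass-interval N k' (suc j) _ 1+j<N | inj₁ (s≤s k'≤j) = begin
    mass (interval k' (suc j)) N
  ≡⟨ mass-cong N (interval-step k'≤j) ⟩
    mass (interval k' j ∪ point (suc j)) N
  ≡⟨ mass-disjoint N (interval k' j) (point (suc j)) disjoint ⟩
    mass (interval k' j) N + mass (point (suc j)) N
  ≡⟨ cong₂ _+_ (mass-interval N k' j k'≤j (<-trans (n<1+n j) 1+j<N)) (mass-point N (suc j) 1+j<N) ⟩
    (T j ∸ T k') + suc j
  ≡⟨ +-comm (T j ∸ T k') (suc j) ⟩
    suc j + (T j ∸ T k')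
  ≡⟨ sym (+-∸-assoc (suc j) (T-mono k'≤j)) ⟩
    T (suc j) ∸ T k' ∎
  where
    open ≡-Reasoning
    disjoint : ∀ z → True (interval k' j z) → ¬ True (point (suc j) z)
    disjoint z z∈ z≡ = <⇒≱ (subst (j <_) (sym (≡ᵇ⇒≡ z (suc j) z≡)) (n<1+n j)) (proj₂ (interval-bounds k' j z z∈))

-- f(n) is the least k with n ≤ T k, and g(n) = T(f n) − n; the search
-- for f(n) terminates within n steps because n ≤ T n.
T-≥ : ∀ n → n ≤ T n
T-≥ zero    = z≤n
T-≥ (suc n) = m≤m+n (suc n) (T n)

fSearch-spec : ∀ n fuel k → n ≤ T (fuel + k) → (∀ j → j < k → T j < n) →
  n ≤ T (fSearch n fuel k) × (∀ j → j < fSearch n fuel k → T j < n)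
fSearch-spec n zero       k n≤T below = n≤T , below
fSearch-spec n (suc fuel) k n≤T below with n ≤ᵇ T k in found
... | true  = ≤ᵇ⇒≤ n (T k) (subst True (sym found) tt) , below
... | false = fSearch-spec n fuel (suc k) (subst (λ i → n ≤ T i) (sym (+-suc fuel k)) n≤T) below′
  where
    below′ : ∀ j → j < suc k → T j < n
    below′ j j<1+k with m≤n⇒m<n∨m≡n (s≤s⁻¹ j<1+k)
    ... | inj₁ j<k = below j j<k
    ... | inj₂ refl = ≰⇒> (λ n≤Tj → subst True found (≤⇒≤ᵇ n≤Tj))

f-spec : ∀ n → n ≤ T (f n) × (∀ j → j < f n → T j < n)
f-spec n = fSearch-spec n n 0 (subst (λ i → n ≤ T i) (sym (+-identityʳ n)) (T-≥ n)) (λ j ())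

f-large : ∀ n → n ≤ T (f n)
f-large n = proj₁ (f-spec n)

f-least : ∀ n j → n ≤ T j → f n ≤ j
f-least n j n≤Tj with f n ≤? j
... | yes fn≤j = fn≤j
... | no  fn≰j = contradiction n≤Tj (<⇒≱ (proj₂ (f-spec n) j (≰⇒> fn≰j)))

f≤id : ∀ n → f n ≤ n
f≤id n = f-least n n (T-≥ n)

f∘g≤f : ∀ n → f (g n) ≤ f n
f∘g≤f n = f-least (g n) (f n) (m∸n≤m (T (f n)) n)

-- g(m) ≤ f(m): by minimality T(f m − 1) < m, so T(f m) < m + f m.
g≤f : ∀ m → g m ≤ f m
g≤f m = m≤n+o⇒m∸n≤o (T (f m)) m (T-bound (f m) (proj₂ (f-spec m)))
  where
    T-bound : ∀ k → (∀ j → j < k → T j < m) → T k ≤ m + k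
    T-bound zero    _     = z≤n
    T-bound (suc j) below = begin
        suc j + T j   ≤⟨ +-monoʳ-≤ (suc j) (<⇒≤ (below j ≤-refl)) ⟩
        suc j + m     ≡⟨ +-comm (suc j) m ⟩
        m + suc j     ∎
      where open ≤-Reasoning

-- Two steps of g are undone by adding the interval {f(g n)+1, …, f n}:
-- g(g n) + (T(f n) − T(f(g n))) = n.
g∘g-volume : ∀ n → g (g n) + (T (f n) ∸ T (f (g n))) ≡ n
g∘g-volume n = begin
    (T k' ∸ m) + (T k ∸ T k')
  ≡⟨ +-comm (T k' ∸ m) (T k ∸ T k') ⟩
    (T k ∸ T k') + (T k' ∸ m)
  ≡⟨ sym (+-∸-assoc (T k ∸ T k') (f-large m)) ⟩
    (T k ∸ T k') + T k' ∸ m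
  ≡⟨ cong (_∸ m) (m∸n+n≡m (T-mono (f∘g≤f n))) ⟩
    T k ∸ m
  ≡⟨ m∸[m∸n]≡n (f-large n) ⟩
    n ∎
  where
    open ≡-Reasoning
    k = f n
    m = g n
    k' = f m

¬True⇒≡false : ∀ {b} → ¬ True b → b ≡ false
¬True⇒≡false {false} _  = refl
¬True⇒≡false {true}  b∉ = contradiction tt b∉

mem-beyond : ∀ A z → length A ≤ z → ¬ True (mem A z)
mem-beyond []      z       _           ()
mem-beyond (b ∷ A) (suc z) (s≤s |A|≤z) = mem-beyond A z |A|≤z

mem-bounded : ∀ A z → True (mem A z) → z < length A
mem-bounded A z z∈A with z <? length A
... | yes z<|A| = z<|A|
... | no  z≮|A| = contradiction z∈A (mem-beyond A z (≮⇒≥ z≮|A|))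

fromPred : DecSet → ℕ → FinSet
fromPred p zero    = []
fromPred p (suc N) = p 0 ∷ fromPred (λ z → p (suc z)) N

length-fromPred : ∀ p N → length (fromPred p N) ≡ N
length-fromPred p zero    = refl
length-fromPred p (suc N) = cong suc (length-fromPred (λ z → p (suc z)) N)

mem-fromPred : ∀ p N → (∀ z → N ≤ z → ¬ True (p z)) → ∀ z → mem (fromPred p N) z ≡ p z
mem-fromPred p zero    bounded z       = sym (¬True⇒≡false (bounded z z≤n))
mem-fromPred p (suc N) bounded zero    = refl
mem-fromPred p (suc N) bounded (suc z) =
  mem-fromPred (λ z → p (suc z)) N (λ z N≤z → bounded (suc z) (s≤s N≤z)) z

vol≡mass : ∀ A N → length A ≤ N → vol A ≡ mass (mem A) N
vol≡mass A N |A|≤N = trans (sumWhere≡mass (mem A) (length A))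
                           (sym (mass-beyond (mem A) (mem-beyond A) |A|≤N))

per≡mass : ∀ A N → length A ≤ N → per A ≡ mass (bd (mem A)) N
per≡mass A N |A|≤N = begin
    per A
  ≡⟨ sumWhere≡mass (inBd A) (length A) ⟩
    mass (inBd A) (length A)
  ≡⟨ mass-cong (length A) inBd≡bd ⟩
    mass (bd (mem A)) (length A)
  ≡⟨ sym (mass-beyond (bd (mem A)) beyond |A|≤N) ⟩
    mass (bd (mem A)) N ∎
  where
    open ≡-Reasoning
    inBd≡bd : ∀ z → inBd A z ≡ bd (mem A) z
    inBd≡bd zero    = refl
    inBd≡bd (suc z) = refl
    beyond : ∀ z → length A ≤ z → ¬ True (bd (mem A) z)
    beyond z |A|≤z z∈∂ = mem-beyond A z |A|≤z (proj₁ (Equivalence.to T-∧ z∈∂))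

perC≡mass : ∀ A N → suc (suc (length A)) ≤ N → perC A ≡ mass (bdᶜ (mem A)) N
perC≡mass A N 2+|A|≤N = begin
    perC A
  ≡⟨ sumWhere≡mass (inBdC A) (suc (suc (length A))) ⟩
    mass (inBdC A) (suc (suc (length A)))
  ≡⟨ mass-cong (suc (suc (length A))) inBdC≡bdᶜ ⟩
    mass (bdᶜ (mem A)) (suc (suc (length A)))
  ≡⟨ sym (mass-beyond (bdᶜ (mem A)) beyond 2+|A|≤N) ⟩
    mass (bdᶜ (mem A)) N ∎
  where
    open ≡-Reasoning
    inBdC≡bdᶜ : ∀ z → inBdC A z ≡ bdᶜ (mem A) z
    inBdC≡bdᶜ zero    = refl
    inBdC≡bdᶜ (suc z) = refl
    -- far from A, a point of A^c has both neighbours in A^c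
    beyond : ∀ z → suc (suc (length A)) ≤ z → ¬ True (bdᶜ (mem A) z)
    beyond (suc z) (s≤s 1+|A|≤z) z∈∂ with Equivalence.to T-∨ (proj₂ (Equivalence.to T-∧ z∈∂))
    ... | inj₁ z∈A   = mem-beyond A z (≤-trans (n≤1+n _) 1+|A|≤z) z∈A
    ... | inj₂ 2+z∈A = mem-beyond A (suc (suc z)) (≤-trans (≤-trans (n≤1+n _) 1+|A|≤z) (m≤n+m z 2)) 2+z∈A

Candidate : ℕ → FinSet → Set
Candidate n A = length A ≡ suc n × vol A ≡ n

minOver : (FinSet → ℕ) → ℕ → ℕ
minOver μ n = minimum (μ (single n)) (map μ (volSets n))

minimum-≤ : ∀ d xs {x} → x ∈ xs → minimum d xs ≤ x
minimum-≤ d (y ∷ xs) (here refl) = m⊓n≤m y (minimum d xs)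
minimum-≤ d (y ∷ xs) (there x∈) = ≤-trans (m⊓n≤n y (minimum d xs)) (minimum-≤ d xs x∈)

minimum-sel : ∀ d xs → minimum d xs ≡ d ⊎ minimum d xs ∈ xs
minimum-sel d []       = inj₁ refl
minimum-sel d (y ∷ xs) with ⊓-sel y (minimum d xs)
... | inj₁ min≡y = inj₂ (here min≡y)
... | inj₂ min≡m with minimum-sel d xs
...   | inj₁ m≡d  = inj₁ (trans min≡m m≡d)
...   | inj₂ m∈xs = inj₂ (there (subst (_∈ xs) (sym min≡m) m∈xs))

extensions : FinSet → List FinSet
extensions A = (false ∷ A) ∷ (true ∷ A) ∷ []

subsets-complete : ∀ A → A ∈ subsetsBelow (length A)
subsets-complete []      = here refl
subsets-complete (b ∷ A) = ∈-concatMap⁺ extensions (Any.map (λ { refl → extension b }) (subsets-complete A))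
  where
    extension : ∀ b → (b ∷ A) ∈ extensions A
    extension false = here refl
    extension true  = there (here refl)

subsets-length : ∀ k {B} → B ∈ subsetsBelow k → length B ≡ k
subsets-length zero    (here refl) = refl
subsets-length (suc k) B∈ with find (∈-concatMap⁻ extensions {xs = subsetsBelow k} B∈)
... | A , A∈ , here refl         = cong suc (subsets-length k A∈)
... | A , A∈ , there (here refl) = cong suc (subsets-length k A∈)

minOver-≤ : ∀ (μ : FinSet → ℕ) n A → Candidate n A → minOver μ n ≤ μ A
minOver-≤ μ n A (|A|≡1+n , volA≡n) =
  minimum-≤ (μ (single n)) (map μ (volSets n))
    (∈-map⁺ μ (∈-filter⁺ (λ A → vol A ≟ n) (subst (λ l → A ∈ subsetsBelow l) |A|≡1+n (subsets-complete A)) volA≡n))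

mem-single : ∀ m z → mem (single m) z ≡ point m z
mem-single zero    zero    = refl
mem-single zero    (suc z) = refl
mem-single (suc m) zero    = refl
mem-single (suc m) (suc z) = mem-single m z

length-single : ∀ m → length (single m) ≡ suc m
length-single zero    = refl
length-single (suc m) = cong suc (length-single m)

single-candidate : ∀ m → Candidate m (single m)
single-candidate m = length-single m , (begin
    vol (single m)                  ≡⟨ vol≡mass (single m) (suc m) (≤-reflexive (length-single m)) ⟩
    mass (mem (single m)) (suc m)   ≡⟨ mass-cong (suc m) (mem-single m) ⟩
    mass (point m) (suc m)          ≡⟨ mass-point (suc m) m ≤-refl ⟩
    m                               ∎)
  where open ≡-Reasoning

minOver-attained : ∀ (μ : FinSet → ℕ) m → Σ FinSet λ B → Candidate m B × minOver μ m ≡ μ B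
minOver-attained μ m with minimum-sel (μ (single m)) (map μ (volSets m))
... | inj₁ min≡ = single m , single-candidate m , min≡
... | inj₂ min∈ with ∈-map⁻ μ min∈
...   | B , B∈ , min≡ with ∈-filter⁻ (λ A → vol A ≟ m) {xs = subsetsBelow (suc m)} B∈
...     | B∈subsets , volB≡m = B , (subsets-length (suc m) B∈subsets , volB≡m) , min≡

module AddInterval (B : FinSet) (k' k N : ℕ)
                   (B⊆ : length B ≤ suc k') (k'≤k : k' ≤ k) (k<N : k < N) where

  union : DecSet
  union = mem B ∪ interval k' k

  A : FinSet
  A = fromPred union N

  |B|≤N : length B ≤ N
  |B|≤N = ≤-trans B⊆ (≤-trans (s≤s k'≤k) k<N)

  union-bounded : ∀ z → N ≤ z → ¬ True (union z)
  union-bounded z N≤z z∈ with Equivalence.to T-∨ z∈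
  ... | inj₁ z∈B = mem-beyond B z (≤-trans |B|≤N N≤z) z∈B
  ... | inj₂ z∈I = interval-beyond k' k z (<-≤-trans k<N N≤z) z∈I

  mem-A : ∀ z → mem A z ≡ union z
  mem-A = mem-fromPred union N union-bounded

  length-A : length A ≡ N
  length-A = length-fromPred union N

  vol-A : vol A ≡ vol B + (T k ∸ T k')
  vol-A = begin
      vol A                                        ≡⟨ vol≡mass A N (≤-reflexive length-A) ⟩
      mass (mem A) N                               ≡⟨ mass-cong N mem-A ⟩
      mass union N                                 ≡⟨ mass-disjoint N (mem B) (interval k' k) disjoint ⟩
      mass (mem B) N + mass (interval k' k) N      ≡⟨ cong₂ _+_ (sym (vol≡mass B N |B|≤N))
                                                                (mass-interval N k' k k'≤k k<N) ⟩
      vol B + (T k ∸ T k')                         ∎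
    where
      open ≡-Reasoning
      disjoint : ∀ z → True (mem B z) → ¬ True (interval k' k z)
      disjoint z z∈B z∈I = <⇒≱ (proj₁ (interval-bounds k' k z z∈I))
                                (s≤s⁻¹ (≤-trans (mem-bounded B z z∈B) B⊆))

  per-A : per A ≤ per B + (suc k' + k)
  per-A = begin
      per A                                                ≡⟨ per≡mass A N (≤-reflexive length-A) ⟩
      mass (bd (mem A)) N                                  ≡⟨ mass-cong N (bd-cong mem-A) ⟩
      mass (bd union) N                                    ≤⟨ mass-cover N (bd union) (bd (mem B)) (bd (interval k' k))
                                                                (λ z → bd-∪ (mem B) (interval k' k) (suc z)) ⟩
      mass (bd (mem B)) N + mass (bd (interval k' k)) N    ≤⟨ +-mono-≤ (≤-reflexive (sym (per≡mass B N |B|≤N)))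
                                                                (mass-two-points N _ (suc k') k
                                                                  (λ z → bd-interval k' k (suc z))) ⟩
      per B + (suc k' + k)                                 ∎
    where open ≤-Reasoning

  perC-A : perC A ≤ perC B + (k' + suc k)
  perC-A = begin
      perC A                                               ≡⟨ perC≡mass A N₂ (≤-reflexive (cong (λ l → suc (suc l)) length-A)) ⟩
      mass (bdᶜ (mem A)) N₂                                ≡⟨ mass-cong N₂ (bdᶜ-cong mem-A) ⟩
      mass (bdᶜ union) N₂                                  ≤⟨ mass-cover N₂ (bdᶜ union) (bdᶜ (mem B)) (bdᶜ (interval k' k))
                                                                (λ z → bdᶜ-∪ (mem B) (interval k' k) (suc z)) ⟩
      mass (bdᶜ (mem B)) N₂ + mass (bdᶜ (interval k' k)) N₂ ≤⟨ +-mono-≤ (≤-reflexive (sym (perC≡mass B N₂ (s≤s (s≤s |B|≤N)))))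
                                                                (mass-two-points N₂ _ k' (suc k) (bdᶜ-interval k' k)) ⟩
      perC B + (k' + suc k)                                ∎
    where
      open ≤-Reasoning
      N₂ = suc (suc N)

extend : ∀ x B → Candidate (g (g x)) B →
  Σ FinSet λ A → Candidate x A
               × per A ≤ suc (f x + f (g x)) + per B
               × perC A ≤ suc (f x + f (g x)) + perC B
extend x B (|B|≡ , volB≡) =
  A , (length-A , vol-x) , ≤-trans per-A (≤-reflexive (move k k' (per B)))
                        , ≤-trans perC-A (≤-reflexive (move′ k k' (perC B)))
  where
    k = f x
    k' = f (g x)
    open AddInterval B k' k (suc x) (≤-trans (≤-reflexive |B|≡) (s≤s (g≤f (g x)))) (f∘g≤f x) (s≤s (f≤id x))
    vol-x : vol A ≡ x
    vol-x = trans vol-A (trans (cong (_+ (T k ∸ T k')) volB≡) (g∘g-volume x))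
    move : ∀ a b p → p + (suc b + a) ≡ suc (a + b) + p
    move = solve-∀
    move′ : ∀ a b p → p + (b + suc a) ≡ suc (a + b) + p
    move′ = solve-∀

minOver-step : ∀ (μ : FinSet → ℕ) (c : ℕ → ℕ) →
  (∀ x B → Candidate (g (g x)) B → Σ FinSet λ A → Candidate x A × μ A ≤ c x + μ B) →
  ∀ x → minOver μ x ≤ c x + minOver μ (g (g x))
minOver-step μ c improve x with minOver-attained μ (g (g x))
... | B , B-cand , min≡μB with improve x B B-cand
...   | A , A-cand , μA≤ = ≤-trans (minOver-≤ μ x A A-cand)
                                   (≤-trans μA≤ (≤-reflexive (cong (c x +_) (sym min≡μB))))

P-recursion : ∀ x → P x ≤ suc (f x + f (g x)) + P (g (g x))
P-recursion = minOver-step per (λ x → suc (f x + f (g x)))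
  (λ x B B-cand → let A , A-cand , per-bound , _ = extend x B B-cand in A , A-cand , per-bound)

Q-recursion : ∀ x → Q x ≤ suc (f x + f (g x)) + Q (g (g x))
Q-recursion = minOver-step perC (λ x → suc (f x + f (g x)))
  (λ x B B-cand → let A , A-cand , _ , perC-bound = extend x B B-cand in A , A-cand , perC-bound)

iterate : ∀ (R a h : ℕ → ℕ) → (∀ x → R x ≤ suc (a x + a (h x)) + R (h (h x))) → ∀ n L →
  R n ≤ L + R ((h ^[ 2 * L ]) n) + sumBelow (2 * L) (λ i → a ((h ^[ i ]) n))
iterate R a h step n zero    = ≤-reflexive (sym (+-identityʳ (R n)))
iterate R a h step n (suc L) rewrite +-suc L (L + 0) = begin
    R n                                               ≤⟨ iterate R a h step n L ⟩
    L + R x + S                                       ≤⟨ +-monoˡ-≤ S (+-monoʳ-≤ L (step x)) ⟩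
    L + (suc (a x + a (h x)) + R (h (h x))) + S       ≡⟨ rearrange L (a x) (a (h x)) (R (h (h x))) S ⟩
    suc L + R (h (h x)) + (S + a x + a (h x))         ∎
  where
    open ≤-Reasoning
    x = (h ^[ 2 * L ]) n
    S = sumBelow (2 * L) (λ i → a ((h ^[ i ]) n))
    rearrange : ∀ l u v r s → l + (suc (u + v) + r) + s ≡ suc l + r + (s + u + v)
    rearrange = solve-∀

corollary11 : (n L : ℕ) →
    (P n ≤ L + P ((g ^[ 2 * L ]) n) + sumBelow (2 * L) (λ i → f ((g ^[ i ]) n)))
    × (Q n ≤ L + Q ((g ^[ 2 * L ]) n) + sumBelow (2 * L) (λ i → f ((g ^[ i ]) n)))
corollary11 n L = iterate P f g P-recursion n L , iterate Q f g Q-recursion n L
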